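{- Let $v,w\in\mathbb{Z}^3\setminus\{0\}$. Assume that the Euclidean norm $|v|$ is an integer and that $(v,w)=0$. Then $v_p(|w|^2)$ is even for every prime $p$ with $p\equiv 3 \pmod 4$.
   Context: $(\cdot,\cdot)$ denotes the standard inner product on $\mathbb{R}^3$, $|w|^2=(w,w)$, and $v_p$ denotes the normalized $p$-adic valuation on $\mathbb{Q}$. -}

module Defs where

open import Data.Nat using (ℕ; suc; _^_)
open import Data.Nat.Divisibility using (_∣_)
open import Data.Integer using (ℤ; _+_; _*_)
open import Data.Product using (_×_)
open import Relation.Nullary using (¬_)

ℤ³ : Set
ℤ³ = ℤ × ℤ × ℤ

⟪_,_⟫ : ℤ³ → ℤ³ → ℤ
⟪ (a₁ Data.Product., a₂ Data.Product., a₃) , (b₁ Data.Product., b₂ Data.Product., b₃) ⟫ =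
  a₁ * b₁ + a₂ * b₂ + a₃ * b₃

∣_∣² : ℤ³ → ℤ
∣ w ∣² = ⟪ w , w ⟫

IsValuation : ℕ → ℕ → ℕ → Set
IsValuation p N k = (p ^ k ∣ N) × ¬ (p ^ suc k ∣ N)

{-# OPTIONS --safe #-}
-- Write v = (a, b, c) and w = (x, y, z), permuted cyclically so that a² + b² ≠ 0. Since ax + by = −cz
-- and a² + b² = n² − c², Lagrange's identity gives (a² + b²)|w|² = (nz)² + (ay − bx)²: a nonzero sum
-- of two squares S times |w|² is a sum of two squares. A prime p ≡ 3 (mod 4) dividing x² + y² divides
-- both x and y, because −1 is not a square mod p (Fermat's little theorem, (p − 1)/2 being odd).
-- Hence p² can be cancelled from S and S|w|² until p ∤ S, and then from |w|² itself, two factors of p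
-- at a time, until none is left.
module Submission where

open import Defs
open import Data.Nat using (ℕ; _*_; _%_)
open import Data.Nat.Primality using (Prime)
open import Data.Integer using (ℤ; +_; 0ℤ; ∣_∣)
open import Data.Product using (_,_; ∃; ∃-syntax; _×_)
open import Relation.Binary.PropositionalEquality using (_≡_; _≢_)

open import Data.Nat using (_+_; _≟_)
import Data.Nat.Properties as ℕ
open import Data.Integer using (-[1+_])
import Data.Integer as ℤ
import Data.Integer.Properties as ℤ
import Data.Integer.Tactic.RingSolver as ℤ-Solver
open import Data.Sum using (inj₁; inj₂)
open import Relation.Nullary using (yes; no)
open import Relation.Binary.PropositionalEquality using (refl; sym; trans; cong; cong₂; subst; module ≡-Reasoning)

module SumsOfTwoSquares where

  open import Level using (0ℓ)
  open import Algebra.Bundles using (CommutativeSemiring)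
  open import Algebra.Structures using (IsCommutativeSemiring)
  open import Algebra.Structures.Biased using (isCommutativeSemiringˡ)
  open import Data.Nat
    using (zero; suc; _^_; _!; _∸_; _<_; z<s; s<s; s≤s; NonZero; ≢-nonZero; nonTrivial⇒n>1)
  open import Data.Nat.Properties using (_!*_!≢0)
  open import Data.Nat.Combinatorics using (_C_; nCk≡n!/k![n-k]!; k![n∸k]!∣n!; nCn≡1)
  open import Data.Nat.DivMod using (_/_; %-distribˡ-+; %-distribˡ-*; m*n%n≡0; m/n*n≡m; m≡m%n+[m/n]*n)
  open import Data.Nat.Divisibility
    using (_∣_; divides; _∣?_; ∣⇒≤; ∣1⇒≡1; ∣-trans; m∣m*n; n∣m*n; 1∣_; ∣m+n∣m⇒∣n;
           *-cancelˡ-∣; *-monoʳ-∣; n∣m⇒m%n≡0; m%n≡0⇒n∣m)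
  open import Data.Nat.Induction using (<-wellFounded)
  open import Data.Nat.Primality using (euclidsLemma; ¬prime[1]; prime⇒nonZero; prime⇒nonTrivial)
  open import Data.Nat.Tactic.RingSolver using (solve-∀)
  open import Data.Fin using (zero; toℕ; fromℕ)
  open import Data.Fin.Properties using (inject₁ℕ<; toℕ-fromℕ)
  open import Data.Vec.Functional using (Vector; init; tail; last)
  open import Data.Product using (∃₂)
  open import Function using (_$_)
  open import Induction.WellFounded using (Acc; acc)
  open import Relation.Binary.Structures using (IsEquivalence)
  open import Relation.Nullary using (¬_; contradiction)

  module Modulo (n : ℕ) .{{_ : NonZero n}} where

    -- A record rather than the bare equation, so that _≈_ is injective and Agda can infer its arguments.
    infix 4 _≈_
    record _≈_ (a b : ℕ) : Set where
      constructor mod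
      field %-≡ : a % n ≡ b % n
    open _≈_ public

    private
      ≡⇒≈ : ∀ {a b} → a ≡ b → a ≈ b
      ≡⇒≈ eq = mod (cong (_% n) eq)

      isEquivalence : IsEquivalence _≈_
      isEquivalence = record
        { refl  = mod refl
        ; sym   = λ (mod eq) → mod (sym eq)
        ; trans = λ (mod eq) (mod eq′) → mod (trans eq eq′)
        }

      +-cong : ∀ {a b c d} → a ≈ b → c ≈ d → a + c ≈ b + d
      +-cong {a} {b} {c} {d} (mod a≈b) (mod c≈d) = mod $ begin
        (a + c) % n                 ≡⟨ %-distribˡ-+ a c n ⟩
        (a % n + c % n) % n         ≡⟨ cong₂ (λ x y → (x + y) % n) a≈b c≈d ⟩
        (b % n + d % n) % n         ≡⟨ %-distribˡ-+ b d n ⟨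
        (b + d) % n                 ∎
        where open ≡-Reasoning

      *-cong : ∀ {a b c d} → a ≈ b → c ≈ d → a * c ≈ b * d
      *-cong {a} {b} {c} {d} (mod a≈b) (mod c≈d) = mod $ begin
        (a * c) % n                 ≡⟨ %-distribˡ-* a c n ⟩
        (a % n * (c % n)) % n       ≡⟨ cong₂ (λ x y → (x * y) % n) a≈b c≈d ⟩
        (b % n * (d % n)) % n       ≡⟨ %-distribˡ-* b d n ⟨
        (b * d) % n                 ∎
        where open ≡-Reasoning

    isCommutativeSemiring : IsCommutativeSemiring _≈_ _+_ _*_ 0 1
    isCommutativeSemiring = isCommutativeSemiringˡ record
      { +-isCommutativeMonoid = record
        { isMonoid = record
          { isSemigroup = record
            { isMagma = record { isEquivalence = isEquivalence ; ∙-cong = +-cong }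
            ; assoc = λ a b c → ≡⇒≈ (ℕ.+-assoc a b c) }
          ; identity = (λ a → ≡⇒≈ (ℕ.+-identityˡ a)) , (λ a → ≡⇒≈ (ℕ.+-identityʳ a)) }
        ; comm = λ a b → ≡⇒≈ (ℕ.+-comm a b) }
      ; *-isCommutativeMonoid = record
        { isMonoid = record
          { isSemigroup = record
            { isMagma = record { isEquivalence = isEquivalence ; ∙-cong = *-cong }
            ; assoc = λ a b c → ≡⇒≈ (ℕ.*-assoc a b c) }
          ; identity = (λ a → ≡⇒≈ (ℕ.*-identityˡ a)) , (λ a → ≡⇒≈ (ℕ.*-identityʳ a)) }
        ; comm = λ a b → ≡⇒≈ (ℕ.*-comm a b) }
      ; distribʳ = λ a b c → ≡⇒≈ (ℕ.*-distribʳ-+ a b c)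
      ; zeroˡ = λ a → mod refl
      }

    commutativeSemiring : CommutativeSemiring 0ℓ 0ℓ
    commutativeSemiring = record { isCommutativeSemiring = isCommutativeSemiring }

    ∣⇒≈0 : ∀ {a} → n ∣ a → a ≈ 0
    ∣⇒≈0 {a} n∣a = mod (trans (n∣m⇒m%n≡0 a n n∣a) (sym (m*n%n≡0 0 n)))

    ≈0⇒∣ : ∀ {a} → a ≈ 0 → n ∣ a
    ≈0⇒∣ {a} (mod eq) = m%n≡0⇒n∣m a n (trans eq (m*n%n≡0 0 n))

  prime∤! : ∀ {p m} → Prime p → m < p → ¬ p ∣ m !
  prime∤! {p} {zero} pr _ p∣1 = ¬prime[1] (subst Prime (∣1⇒≡1 p∣1) pr)
  prime∤! {p} {suc m} pr m<p p∣m! with euclidsLemma (suc m) (m !) pr p∣m!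
  ... | inj₁ p∣m = ℕ.<⇒≱ m<p (∣⇒≤ p∣m)
  ... | inj₂ p∣m! = prime∤! pr (ℕ.≤-trans (ℕ.n≤1+n _) m<p) p∣m!

  prime∣C : ∀ {p k} → Prime p → 0 < k → k < p → p ∣ p C k
  prime∣C {suc n} {suc j} pr _ k<p
    with euclidsLemma (suc n C suc j) (suc j ! * (n ∸ j) !) pr p∣C*k![p∸k]!
    where
    instance _ = suc j !* (n ∸ j) !≢0
    p∣C*k![p∸k]! : suc n ∣ (suc n C suc j) * (suc j ! * (n ∸ j) !)
    p∣C*k![p∸k]! = subst (suc n ∣_) (sym (begin
      (suc n C suc j) * (suc j ! * (n ∸ j) !)
        ≡⟨ cong (_* (suc j ! * (n ∸ j) !)) (nCk≡n!/k![n-k]! (ℕ.<⇒≤ k<p)) ⟩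
      (suc n ! / (suc j ! * (n ∸ j) !)) * (suc j ! * (n ∸ j) !)
        ≡⟨ m/n*n≡m (k![n∸k]!∣n! (ℕ.<⇒≤ k<p)) ⟩
      suc n ! ∎)) (m∣m*n (n !))
      where open ≡-Reasoning
  ... | inj₁ p∣C = p∣C
  ... | inj₂ p∣k![p∸k]! with euclidsLemma (suc j !) ((n ∸ j) !) pr p∣k![p∸k]!
  ...   | inj₁ p∣k! = contradiction p∣k! (prime∤! pr k<p)
  ...   | inj₂ p∣[p∸k]! = contradiction p∣[p∸k]! (prime∤! pr (s≤s (ℕ.m∸n≤m n j)))

  module Fermat {n : ℕ} (p-prime : Prime (suc n)) where

    private
      p = suc n
    open Modulo p
    open CommutativeSemiring commutativeSemiring using (semiring; setoid; +-cong)
      renaming (refl to ≈-refl; trans to ≈-trans; reflexive to ≡⇒≈)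
    open import Algebra.Properties.CommutativeSemiring.Binomial commutativeSemiring
      using (binomialTerm) renaming (theorem to binomialTheorem)
    open import Algebra.Properties.Semiring.Sum semiring using (sum; sum-cong-≋; sum-replicate-zero; sum-init-last)
    open import Algebra.Properties.Semiring.Mult semiring using () renaming (_×_ to _·_)
    import Algebra.Properties.Semiring.Exp semiring as S
    import Relation.Binary.Reasoning.Setoid setoid as ≈-Reasoning

    ·≡* : ∀ k x → k · x ≡ k * x
    ·≡* zero x = refl
    ·≡* (suc k) x = cong (_+_ x) (·≡* k x)

    ^≡^ : ∀ x k → x S.^ k ≡ x ^ k
    ^≡^ x zero = refl
    ^≡^ x (suc k) = cong (x *_) (^≡^ x k)

    ∣⇒·≈0 : ∀ {k} b → p ∣ k → k · b ≈ 0
    ∣⇒·≈0 {k} b p∣k = ≈-trans (≡⇒≈ (·≡* k b)) (∣⇒≈0 (∣-trans p∣k (m∣m*n b)))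

    private
      module _ (x y : ℕ) where
        term : Vector ℕ (suc p)
        term = binomialTerm x y p

        term₀≡y^p : term zero ≡ y ^ p
        term₀≡y^p = begin
          (p C 0) · (1 * y S.^ p) ≡⟨⟩
          1 · (1 * y S.^ p)       ≡⟨ ·≡* 1 _ ⟩
          1 * (1 * y S.^ p)       ≡⟨ ℕ.*-identityˡ _ ⟩
          1 * y S.^ p             ≡⟨ ℕ.*-identityˡ _ ⟩
          y S.^ p                 ≡⟨ ^≡^ y p ⟩
          y ^ p                   ∎
          where open ≡-Reasoning

        termₚ≡x^p : last (tail term) ≡ x ^ p
        termₚ≡x^p = begin
          (p C suc (toℕ (fromℕ n))) · (x S.^ suc (toℕ (fromℕ n)) * y S.^ (n ∸ toℕ (fromℕ n)))
            ≡⟨ cong (λ k → (p C suc k) · (x S.^ suc k * y S.^ (n ∸ k))) (toℕ-fromℕ n) ⟩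
          (p C p) · (x S.^ p * y S.^ (n ∸ n))
            ≡⟨ cong₂ (λ c e → c · (x S.^ p * y S.^ e)) (nCn≡1 p) (ℕ.n∸n≡0 n) ⟩
          1 · (x S.^ p * 1) ≡⟨ ·≡* 1 _ ⟩
          1 * (x S.^ p * 1) ≡⟨ ℕ.*-identityˡ _ ⟩
          x S.^ p * 1       ≡⟨ ℕ.*-identityʳ _ ⟩
          x S.^ p           ≡⟨ ^≡^ x p ⟩
          x ^ p             ∎
          where open ≡-Reasoning

        middleTerm≈0 : ∀ i → init (tail term) i ≈ 0
        middleTerm≈0 i = ∣⇒·≈0 _ (prime∣C p-prime z<s (s<s (inject₁ℕ< i)))

    freshmansDream : ∀ x y → (x + y) ^ p ≈ x ^ p + y ^ p
    freshmansDream x y = begin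
      (x + y) ^ p
        ≡⟨ ^≡^ (x + y) p ⟨
      (x + y) S.^ p
        ≈⟨ binomialTheorem p x y ⟩
      term x y zero + sum (tail (term x y))
        ≈⟨ +-cong (≡⇒≈ (term₀≡y^p x y)) (sum-init-last (tail (term x y))) ⟩
      y ^ p + (sum (init (tail (term x y))) + last (tail (term x y)))
        ≈⟨ +-cong (≈-refl {y ^ p}) (+-cong middleSum≈0 (≡⇒≈ (termₚ≡x^p x y))) ⟩
      y ^ p + (0 + x ^ p)
        ≡⟨ ℕ.+-comm (y ^ p) (x ^ p) ⟩
      x ^ p + y ^ p ∎
      where
      open ≈-Reasoning
      middleSum≈0 : sum (init (tail (term x y))) ≈ 0
      middleSum≈0 = ≈-trans (sum-cong-≋ (middleTerm≈0 x y)) (sum-replicate-zero n)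

    fermatsLittleTheorem : ∀ a → a ^ p ≈ a
    fermatsLittleTheorem zero = ≈-refl
    fermatsLittleTheorem (suc a) = begin
      suc a ^ p          ≡⟨ cong (_^ p) (ℕ.+-comm 1 a) ⟩
      (a + 1) ^ p        ≈⟨ freshmansDream a 1 ⟩
      a ^ p + 1 ^ p      ≡⟨ cong (_+_ (a ^ p)) (ℕ.^-zeroˡ p) ⟩
      a ^ p + 1          ≈⟨ +-cong (fermatsLittleTheorem a) ≈-refl ⟩
      a + 1              ≡⟨ ℕ.+-comm a 1 ⟩
      suc a              ∎
      where open ≈-Reasoning

  ^[3+4m] : ∀ x m → x ^ (3 + m * 4) ≡ x * (x * x) ^ (1 + m * 2)
  ^[3+4m] x zero = cube x
    where
    cube : ∀ x → x * (x * (x * 1)) ≡ x * (x * x * 1)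
    cube = solve-∀
  ^[3+4m] x (suc m) =
    trans (cong (λ t → x * (x * (x * (x * t)))) (^[3+4m] x m)) (shift x ((x * x) ^ (1 + m * 2)))
    where
    shift : ∀ x W → x * (x * (x * (x * (x * W)))) ≡ x * ((x * x) * ((x * x) * W))
    shift = solve-∀

  module _ {n : ℕ} .{{_ : NonZero n}} where
    open Modulo n
    open CommutativeSemiring commutativeSemiring using (setoid; +-congˡ; *-congˡ; *-congʳ)
      renaming (trans to ≈-trans; reflexive to ≡⇒≈)
    open import Relation.Binary.Reasoning.Setoid setoid

    oddPowerSum≈0 : ∀ {x y} → x + y ≈ 0 → ∀ j → x ^ (1 + j * 2) + y ^ (1 + j * 2) ≈ 0
    oddPowerSum≈0 {x} {y} x+y≈0 zero =
      ≈-trans (≡⇒≈ (cong₂ _+_ (ℕ.*-identityʳ x) (ℕ.*-identityʳ y))) x+y≈0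
    oddPowerSum≈0 {x} {y} x+y≈0 (suc j) = begin
      S₊                      ≡⟨ ℕ.+-identityʳ S₊ ⟨
      S₊ + 0                  ≡⟨ cong (_+_ S₊) (ℕ.*-zeroʳ (x * y)) ⟨
      S₊ + x * y * 0          ≈⟨ +-congˡ {S₊} (*-congˡ {x * y} (oddPowerSum≈0 {x} {y} x+y≈0 j)) ⟨
      S₊ + x * y * (A + B)    ≡⟨ factor x y A B ⟩
      (x + y) * (x * A + y * B) ≈⟨ *-congʳ {x * A + y * B} x+y≈0 ⟩
      0                       ∎
      where
      A = x ^ (1 + j * 2)
      B = y ^ (1 + j * 2)
      S₊ = x * (x * A) + y * (y * B)
      factor : ∀ x y A B → x * (x * A) + y * (y * B) + x * y * (A + B) ≡ (x + y) * (x * A + y * B)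
      factor = solve-∀

  module ThreeModFour {m : ℕ} (p-prime : Prime (3 + m * 4)) where
    private
      p = 3 + m * 4
    open Fermat p-prime using (fermatsLittleTheorem)
    open Modulo p
    open CommutativeSemiring commutativeSemiring using (setoid; +-cong; *-congˡ)
    open import Relation.Binary.Reasoning.Setoid setoid

    -- x² + y² ≡ 0 gives x^(p−1) + y^(p−1) ≡ 0 as (p − 1)/2 is odd; times xy, and by Fermat, 2xy ≡ 0.
    p∣x²+y²⇒p∣x : ∀ x y → p ∣ x * x + y * y → p ∣ x
    p∣x²+y²⇒p∣x x y p∣x²+y² with euclidsLemma 2 (x * y) p-prime (≈0⇒∣ 2xy≈0)
      where
      S = (x * x) ^ (1 + m * 2) + (y * y) ^ (1 + m * 2)
      2xy≈0 : 2 * (x * y) ≈ 0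
      2xy≈0 = begin
        2 * (x * y)                ≡⟨ double x y ⟩
        y * x + x * y
          ≈⟨ +-cong (*-congˡ {y} (fermatsLittleTheorem x)) (*-congˡ {x} (fermatsLittleTheorem y)) ⟨
        y * x ^ p + x * y ^ p      ≡⟨ cong₂ (λ s t → y * s + x * t) (^[3+4m] x m) (^[3+4m] y m) ⟩
        y * (x * (x * x) ^ (1 + m * 2)) + x * (y * (y * y) ^ (1 + m * 2))
                                   ≡⟨ factor x y ((x * x) ^ (1 + m * 2)) ((y * y) ^ (1 + m * 2)) ⟩
        x * y * S                  ≈⟨ *-congˡ {x * y} (oddPowerSum≈0 {p} {x * x} {y * y} (∣⇒≈0 p∣x²+y²) m) ⟩
        x * y * 0                  ≡⟨ ℕ.*-zeroʳ (x * y) ⟩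
        0                          ∎
        where
        double : ∀ x y → 2 * (x * y) ≡ y * x + x * y
        double = solve-∀
        factor : ∀ x y U V → y * (x * U) + x * (y * V) ≡ x * y * (U + V)
        factor = solve-∀
    ... | inj₁ p∣2 = contradiction (∣⇒≤ p∣2) λ { (s≤s (s≤s ())) }
    ... | inj₂ p∣xy with euclidsLemma x y p-prime p∣xy
    ...   | inj₁ p∣x = p∣x
    ...   | inj₂ p∣y with euclidsLemma x x p-prime p∣x*x
      where
      p∣x*x : p ∣ x * x
      p∣x*x = ∣m+n∣m⇒∣n (subst (p ∣_) (ℕ.+-comm (x * x) (y * y)) p∣x²+y²) (∣-trans p∣y (m∣m*n y))
    ...     | inj₁ p∣x = p∣x
    ...     | inj₂ p∣x = p∣x

  prime∣x²+y²⇒∣x : ∀ {p} → Prime p → p % 4 ≡ 3 → ∀ x y → p ∣ x * x + y * y → p ∣ x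
  prime∣x²+y²⇒∣x {p} p-prime p%4≡3 =
    subst (λ q → Prime q → ∀ x y → q ∣ x * x + y * y → q ∣ x) (sym p≡3+[p/4]*4)
      (ThreeModFour.p∣x²+y²⇒p∣x {p / 4}) p-prime
    where
    p≡3+[p/4]*4 : p ≡ 3 + p / 4 * 4
    p≡3+[p/4]*4 = trans (m≡m%n+[m/n]*n p 4) (cong (_+ p / 4 * 4) p%4≡3)

  IsSumOfTwoSquares : ℕ → Set
  IsSumOfTwoSquares n = ∃₂ λ x y → n ≡ x * x + y * y

  IsValuation-p* : ∀ {p N k} .{{_ : NonZero p}} → IsValuation p (p * N) (suc k) → IsValuation p N k
  IsValuation-p* {p} (pᵏ⁺¹∣pN , pᵏ⁺²∤pN) =
    *-cancelˡ-∣ p pᵏ⁺¹∣pN , λ pᵏ⁺¹∣N → pᵏ⁺²∤pN (*-monoʳ-∣ p pᵏ⁺¹∣N)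

  module _ {p : ℕ} (p-prime : Prime p) (p%4≡3 : p % 4 ≡ 3) where

    private
      instance
        p≢0 : NonZero p
        p≢0 = prime⇒nonZero p-prime

      1<p : 1 < p
      1<p = nonTrivial⇒n>1 p {{prime⇒nonTrivial p-prime}}

    cancel-p² : ∀ {a b c} → a ≡ p * (p * b) → a ≡ p * (p * c) → b ≡ c
    cancel-p² {a} {b} {c} a≡p²b a≡p²c =
      ℕ.*-cancelˡ-≡ b c p (ℕ.*-cancelˡ-≡ (p * b) (p * c) p (trans (sym a≡p²b) a≡p²c))

    p∣sumOfTwoSquares⇒p²∣ : ∀ {a} → IsSumOfTwoSquares a → p ∣ a
                          → ∃[ b ] a ≡ p * (p * b) × IsSumOfTwoSquares b
    p∣sumOfTwoSquares⇒p²∣ (x , y , refl) p∣a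
      with prime∣x²+y²⇒∣x p-prime p%4≡3 x y p∣a
         | prime∣x²+y²⇒∣x p-prime p%4≡3 y x (subst (p ∣_) (ℕ.+-comm (x * x) (y * y)) p∣a)
    ... | divides x′ refl | divides y′ refl = x′ * x′ + y′ * y′ , factor x′ y′ p , x′ , y′ , refl
      where
      factor : ∀ x y p → x * p * (x * p) + y * p * (y * p) ≡ p * (p * (x * x + y * y))
      factor = solve-∀

    p²∣m*n⇒p²∣n : ∀ {m n} → ¬ p ∣ m → p * p ∣ m * n → p * p ∣ n
    p²∣m*n⇒p²∣n {m} {n} p∤m p²∣mn with euclidsLemma m n p-prime (∣-trans (m∣m*n p) p²∣mn)
    ... | inj₁ p∣m = contradiction p∣m p∤m
    ... | inj₂ (divides n₁ refl) with euclidsLemma m n₁ p-prime (*-cancelˡ-∣ p p²∣p[mn₁])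
      where
      p²∣p[mn₁] : p * p ∣ p * (m * n₁)
      p²∣p[mn₁] = subst (p * p ∣_) (rearrange m n₁ p) p²∣mn
        where
        rearrange : ∀ m n₁ p → m * (n₁ * p) ≡ p * (m * n₁)
        rearrange = solve-∀
    ...   | inj₁ p∣m = contradiction p∣m p∤m
    ...   | inj₂ p∣n₁ = subst (p * p ∣_) (ℕ.*-comm p n₁) (*-monoʳ-∣ p p∣n₁)

    p∣W⇒p²∣W : ∀ {S W} → ¬ p ∣ S → IsSumOfTwoSquares (S * W) → p ∣ W
             → ∃[ W′ ] W ≡ p * (p * W′) × IsSumOfTwoSquares (S * W′)
    p∣W⇒p²∣W {S} {W} p∤S sos p∣W with p∣sumOfTwoSquares⇒p²∣ sos (∣-trans p∣W (n∣m*n S))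
    ... | T , SW≡p²T , sosT = W′ , W≡p²W′ , subst IsSumOfTwoSquares (sym SW′≡T) sosT
      where
      p²∣W : p * p ∣ W
      p²∣W = p²∣m*n⇒p²∣n p∤S (divides T (trans SW≡p²T (rearrange p T)))
        where
        rearrange : ∀ p T → p * (p * T) ≡ T * (p * p)
        rearrange = solve-∀
      open _∣_ p²∣W renaming (quotient to W′; equality to W≡W′p²)
      W≡p²W′ : W ≡ p * (p * W′)
      W≡p²W′ = trans W≡W′p² (rearrange p W′)
        where
        rearrange : ∀ p W′ → W′ * (p * p) ≡ p * (p * W′)
        rearrange = solve-∀
      SW′≡T : S * W′ ≡ T
      SW′≡T = cancel-p² (trans (cong (S *_) W≡p²W′) (rearrange p S W′)) SW≡p²T
        where
        rearrange : ∀ p S W′ → S * (p * (p * W′)) ≡ p * (p * (S * W′))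
        rearrange = solve-∀

    coprimeCofactor : ∀ {W} S → Acc _<_ S → S ≢ 0 → IsSumOfTwoSquares S → IsSumOfTwoSquares (S * W)
                    → ∃[ S′ ] ¬ p ∣ S′ × IsSumOfTwoSquares (S′ * W)
    coprimeCofactor {W} S (acc rs) S≢0 sosS sosSW with p ∣? S
    ... | no p∤S = S , p∤S , sosSW
    ... | yes p∣S with p∣sumOfTwoSquares⇒p²∣ sosS p∣S
                     | p∣sumOfTwoSquares⇒p²∣ sosSW (∣-trans p∣S (m∣m*n W))
    ...   | S₁ , refl , sosS₁ | T , SW≡p²T , sosT =
      coprimeCofactor S₁ (rs S₁<S) S₁≢0 sosS₁ (subst IsSumOfTwoSquares (sym S₁W≡T) sosT)
      where
      S₁≢0 : S₁ ≢ 0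
      S₁≢0 refl = S≢0 (trans (cong (p *_) (ℕ.*-zeroʳ p)) (ℕ.*-zeroʳ p))
      S₁<S : S₁ < p * (p * S₁)
      S₁<S = ℕ.<-≤-trans (subst (S₁ <_) (ℕ.*-comm S₁ p) (ℕ.m<m*n S₁ p 1<p)) (ℕ.m≤n*m (p * S₁) p)
        where instance _ = ≢-nonZero S₁≢0
      S₁W≡T : S₁ * W ≡ T
      S₁W≡T = cancel-p² (rearrange p S₁ W) SW≡p²T
        where
        rearrange : ∀ p S₁ W → p * (p * S₁) * W ≡ p * (p * (S₁ * W))
        rearrange = solve-∀

    p∤S⇒evenValuation : ∀ {S W} k → ¬ p ∣ S → IsSumOfTwoSquares (S * W) → IsValuation p W k
                          → ∃[ j ] k ≡ 2 * j
    p∤S⇒evenValuation zero _ _ _ = 0 , refl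
    p∤S⇒evenValuation (suc zero) p∤S sos (p∣W , p²∤W) =
      let W′ , W≡p²W′ , _ = p∣W⇒p²∣W p∤S sos (∣-trans (m∣m*n 1) p∣W)
      in contradiction (subst (p ^ 2 ∣_) (sym W≡p²W′) (*-monoʳ-∣ p (*-monoʳ-∣ p (1∣ W′)))) p²∤W
    p∤S⇒evenValuation (suc (suc k)) p∤S sos val@(pᵏ⁺²∣W , _) =
      let W′ , W≡p²W′ , sos′ = p∣W⇒p²∣W p∤S sos (∣-trans (m∣m*n (p ^ suc k)) pᵏ⁺²∣W)
          j , k≡2j = p∤S⇒evenValuation k p∤S sos′
                       (IsValuation-p* {k = k} (IsValuation-p* {k = suc k}
                         (subst (λ N → IsValuation p N (suc (suc k))) W≡p²W′ val)))
      in suc j , trans (cong (λ i → suc (suc i)) k≡2j) (sym (ℕ.*-suc 2 j))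

    evenValuation : ∀ {S W k} → S ≢ 0 → IsSumOfTwoSquares S → IsSumOfTwoSquares (S * W)
                  → IsValuation p W k → ∃[ j ] k ≡ 2 * j
    evenValuation {S} S≢0 sosS sosSW val =
      let S′ , p∤S′ , sosS′W = coprimeCofactor S (<-wellFounded S) S≢0 sosS sosSW
      in p∤S⇒evenValuation _ p∤S′ sosS′W val

open SumsOfTwoSquares using (IsSumOfTwoSquares; evenValuation)

i*i≡∣i∣*∣i∣ : ∀ i → i ℤ.* i ≡ + (∣ i ∣ * ∣ i ∣)
i*i≡∣i∣*∣i∣ (+ n) = sym (ℤ.pos-* n n)
i*i≡∣i∣*∣i∣ -[1+ n ] = refl

∣i*i+j*j∣ : ∀ i j → ∣ i ℤ.* i ℤ.+ j ℤ.* j ∣ ≡ ∣ i ∣ * ∣ i ∣ + ∣ j ∣ * ∣ j ∣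
∣i*i+j*j∣ i j = cong ∣_∣ (trans (cong₂ ℤ._+_ (i*i≡∣i∣*∣i∣ i) (i*i≡∣i∣*∣i∣ j))
                                (sym (ℤ.pos-+ (∣ i ∣ * ∣ i ∣) (∣ j ∣ * ∣ j ∣))))

x*x+y*y≡0⇒x≡0 : ∀ x y → x * x + y * y ≡ 0 → x ≡ 0
x*x+y*y≡0⇒x≡0 x y x²+y²≡0 with ℕ.m*n≡0⇒m≡0∨n≡0 x (ℕ.m+n≡0⇒m≡0 (x * x) x²+y²≡0)
... | inj₁ x≡0 = x≡0
... | inj₂ x≡0 = x≡0

-- Lagrange's identity, rewritten with (ax + by)² = (⟪v,w⟫ − cz)² and a² + b² = ∣v∣² − c².
orthogonal-identity : ∀ {a b c x y z} m → ⟪ (a , b , c) , (x , y , z) ⟫ ≡ 0ℤ → ∣ (a , b , c) ∣² ≡ m ℤ.* m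
  → (a ℤ.* a ℤ.+ b ℤ.* b) ℤ.* ∣ (x , y , z) ∣²
      ≡ (m ℤ.* z) ℤ.* (m ℤ.* z) ℤ.+ (a ℤ.* y ℤ.- b ℤ.* x) ℤ.* (a ℤ.* y ℤ.- b ℤ.* x)
orthogonal-identity {a} {b} {c} {x} {y} {z} m v⊥w ∣v∣²≡m² = begin
  (a ℤ.* a ℤ.+ b ℤ.* b) ℤ.* ∣ (x , y , z) ∣²
    ≡⟨ lagrange a b c x y z m ⟩
  rhs ℤ.+ (⟪ v , w ⟫ ℤ.- + 2 ℤ.* c ℤ.* z) ℤ.* ⟪ v , w ⟫ ℤ.+ (∣ v ∣² ℤ.- m ℤ.* m) ℤ.* (z ℤ.* z)
    ≡⟨ cong₂ (λ s t → rhs ℤ.+ (s ℤ.- + 2 ℤ.* c ℤ.* z) ℤ.* s ℤ.+ t ℤ.* (z ℤ.* z))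
         v⊥w (trans (cong (ℤ._- m ℤ.* m) ∣v∣²≡m²) (ℤ.+-inverseʳ (m ℤ.* m))) ⟩
  rhs ℤ.+ (0ℤ ℤ.- + 2 ℤ.* c ℤ.* z) ℤ.* 0ℤ ℤ.+ 0ℤ ℤ.* (z ℤ.* z)
    ≡⟨ drop-zeros rhs (0ℤ ℤ.- + 2 ℤ.* c ℤ.* z) (z ℤ.* z) ⟩
  rhs ∎
  where
  open ≡-Reasoning
  v w : ℤ³
  v = (a , b , c)
  w = (x , y , z)
  rhs = (m ℤ.* z) ℤ.* (m ℤ.* z) ℤ.+ (a ℤ.* y ℤ.- b ℤ.* x) ℤ.* (a ℤ.* y ℤ.- b ℤ.* x)
  lagrange : ∀ a b c x y z m →
    (a ℤ.* a ℤ.+ b ℤ.* b) ℤ.* (x ℤ.* x ℤ.+ y ℤ.* y ℤ.+ z ℤ.* z)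
      ≡ (m ℤ.* z) ℤ.* (m ℤ.* z) ℤ.+ (a ℤ.* y ℤ.- b ℤ.* x) ℤ.* (a ℤ.* y ℤ.- b ℤ.* x)
        ℤ.+ (a ℤ.* x ℤ.+ b ℤ.* y ℤ.+ c ℤ.* z ℤ.- + 2 ℤ.* c ℤ.* z) ℤ.* (a ℤ.* x ℤ.+ b ℤ.* y ℤ.+ c ℤ.* z)
        ℤ.+ (a ℤ.* a ℤ.+ b ℤ.* b ℤ.+ c ℤ.* c ℤ.- m ℤ.* m) ℤ.* (z ℤ.* z)
  lagrange = ℤ-Solver.solve-∀
  drop-zeros : ∀ s t u → s ℤ.+ t ℤ.* 0ℤ ℤ.+ 0ℤ ℤ.* u ≡ s
  drop-zeros = ℤ-Solver.solve-∀

orthogonal⇒sumOfTwoSquares : ∀ {a b c n} w → ⟪ (a , b , c) , w ⟫ ≡ 0ℤ → ∣ (a , b , c) ∣² ≡ + (n * n)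
  → IsSumOfTwoSquares ((∣ a ∣ * ∣ a ∣ + ∣ b ∣ * ∣ b ∣) * ∣ ∣ w ∣² ∣)
orthogonal⇒sumOfTwoSquares {a} {b} {c} {n} w@(x , y , z) v⊥w ∣v∣²≡n² = ∣ X ∣ , ∣ Y ∣ , (begin
  (∣ a ∣ * ∣ a ∣ + ∣ b ∣ * ∣ b ∣) * ∣ ∣ w ∣² ∣  ≡⟨ cong (_* ∣ ∣ w ∣² ∣) (∣i*i+j*j∣ a b) ⟨
  ∣ a ℤ.* a ℤ.+ b ℤ.* b ∣ * ∣ ∣ w ∣² ∣          ≡⟨ ℤ.abs-* (a ℤ.* a ℤ.+ b ℤ.* b) ∣ w ∣² ⟨
  ∣ (a ℤ.* a ℤ.+ b ℤ.* b) ℤ.* ∣ w ∣² ∣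
    ≡⟨ cong ∣_∣ (orthogonal-identity {a} {b} {c} {x} {y} {z} (+ n) v⊥w (trans ∣v∣²≡n² (ℤ.pos-* n n))) ⟩
  ∣ X ℤ.* X ℤ.+ Y ℤ.* Y ∣                     ≡⟨ ∣i*i+j*j∣ X Y ⟩
  ∣ X ∣ * ∣ X ∣ + ∣ Y ∣ * ∣ Y ∣               ∎)
  where
  open ≡-Reasoning
  X = + n ℤ.* z
  Y = a ℤ.* y ℤ.- b ℤ.* x

rotate : ℤ³ → ℤ³
rotate (a , b , c) = (b , c , a)

⟪rotate,rotate⟫ : ∀ v w → ⟪ rotate v , rotate w ⟫ ≡ ⟪ v , w ⟫
⟪rotate,rotate⟫ (a , b , c) (x , y , z) = cycle a b c x y z
  where
  cycle : ∀ a b c x y z → b ℤ.* y ℤ.+ c ℤ.* z ℤ.+ a ℤ.* x ≡ a ℤ.* x ℤ.+ b ℤ.* y ℤ.+ c ℤ.* z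
  cycle = ℤ-Solver.solve-∀

sumOfTwoSquaresCofactor : ∀ {n} v w → v ≢ (0ℤ , 0ℤ , 0ℤ) → ⟪ v , w ⟫ ≡ 0ℤ → ∣ v ∣² ≡ + (n * n)
  → ∃[ S ] S ≢ 0 × IsSumOfTwoSquares S × IsSumOfTwoSquares (S * ∣ ∣ w ∣² ∣)
sumOfTwoSquaresCofactor {n} (a , b , c) w v≢0 v⊥w ∣v∣²≡n² with ∣ a ∣ * ∣ a ∣ + ∣ b ∣ * ∣ b ∣ ≟ 0
... | no S≢0 = _ , S≢0 , (∣ a ∣ , ∣ b ∣ , refl) , orthogonal⇒sumOfTwoSquares {a} {b} {c} {n} w v⊥w ∣v∣²≡n²
... | yes S≡0 = _ , S′≢0 , (∣ b ∣ , ∣ c ∣ , refl) ,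
  subst (λ N → IsSumOfTwoSquares ((∣ b ∣ * ∣ b ∣ + ∣ c ∣ * ∣ c ∣) * ∣ N ∣)) (⟪rotate,rotate⟫ w w)
    (orthogonal⇒sumOfTwoSquares {b} {c} {a} {n} (rotate w)
      (trans (⟪rotate,rotate⟫ (a , b , c) w) v⊥w)
      (trans (⟪rotate,rotate⟫ (a , b , c) (a , b , c)) ∣v∣²≡n²))
  where
  S′≢0 : ∣ b ∣ * ∣ b ∣ + ∣ c ∣ * ∣ c ∣ ≢ 0
  S′≢0 S′≡0 = v≢0 (cong₂ _,_ (ℤ.∣i∣≡0⇒i≡0 (x*x+y*y≡0⇒x≡0 ∣ a ∣ ∣ b ∣ S≡0))
    (cong₂ _,_ (ℤ.∣i∣≡0⇒i≡0 (x*x+y*y≡0⇒x≡0 ∣ b ∣ ∣ c ∣ S′≡0))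
      (ℤ.∣i∣≡0⇒i≡0 (x*x+y*y≡0⇒x≡0 ∣ c ∣ ∣ b ∣
        (trans (ℕ.+-comm (∣ c ∣ * ∣ c ∣) (∣ b ∣ * ∣ b ∣)) S′≡0)))))

mainTheorem4 : (v w : ℤ³) → v ≢ (0ℤ , 0ℤ , 0ℤ) → w ≢ (0ℤ , 0ℤ , 0ℤ)
    → (∃[ n ] ∣ v ∣² ≡ + (n * n))
    → ⟪ v , w ⟫ ≡ 0ℤ
    → (p : ℕ) → Prime p → p % 4 ≡ 3
    → (k : ℕ) → IsValuation p ∣ ∣ w ∣² ∣ k
    → ∃[ m ] k ≡ 2 * m
mainTheorem4 v w v≢0 _ (n , ∣v∣²≡n²) v⊥w p p-prime p%4≡3 k val =
  let S , S≢0 , sosS , sosSW = sumOfTwoSquaresCofactor {n} v w v≢0 v⊥w ∣v∣²≡n²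
  in evenValuation p-prime p%4≡3 S≢0 sosS sosSW val
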